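{- Let $G$ be a finite group such that $|G|$ is divisible by at least two distinct primes, and let $x,y$ be two distinct elements of $G$. Then $N[x]=N[y]$ in $\mathcal{S}(G)$ if and only if one of the following holds: (i) $o(x)=o(y)$; (ii) $\{o(x),o(y)\}=\{1,\exp(G)\}$; (iii) $\{o(x),o(y)\}=\{p^m,p^n\}$ for some prime $p$ and positive integers $m>n$, and $p^nq\notin\pi_e(G)$ for every prime $q\neq p$.
   Context: The order supergraph $\mathcal{S}(G)$ has vertex set $G$, two distinct vertices $x,y$ adjacent iff $o(x)\mid o(y)$ or $o(y)\mid o(x)$. $N[x]$ is the closed neighborhood of $x$ (the set of vertices at distance at most $1$ from $x$). $\exp(G)$ is the least common multiple of the element orders of $G$, and $\pi_e(G)$ is the set of element orders of $G$. -}

module Defs where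

open import Level using (Level; _⊔_)
open import Data.Nat using (ℕ; zero; suc; _≤_; _<_)
open import Data.Nat.Divisibility using (_∣_)
open import Data.Nat.Primality using (Prime)
open import Data.Fin using (Fin)
open import Data.Product using (Σ; ∃; _×_)
open import Data.Sum using (_⊎_)
open import Relation.Nullary using (¬_)
open import Relation.Binary.PropositionalEquality using (_≡_; _≢_)
import Relation.Binary.PropositionalEquality as ≡
open import Function.Bundles using (Bijection; _⇔_)
open import Algebra.Bundles using (Group)

module _ {c ℓ : Level} (G : Group c ℓ) where
  open Group G

  pow : Carrier → ℕ → Carrier
  pow x zero    = ε
  pow x (suc k) = x ∙ pow x k

  HasCardinality : ℕ → Set (c ⊔ ℓ)
  HasCardinality n = Bijection (≡.setoid (Fin n)) setoid

  HasOrder : Carrier → ℕ → Set ℓ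
  HasOrder x k = (1 ≤ k) × (pow x k ≈ ε) × (∀ j → 1 ≤ j → j < k → ¬ (pow x j ≈ ε))

  InSpectrum : ℕ → Set (c ⊔ ℓ)
  InSpectrum k = ∃ λ x → HasOrder x k

  IsExponent : ℕ → Set (c ⊔ ℓ)
  IsExponent e = (∀ x k → HasOrder x k → k ∣ e)
               × (∀ m → (∀ x k → HasOrder x k → k ∣ m) → e ∣ m)

  Adjacent : Carrier → Carrier → Set ℓ
  Adjacent x y = ¬ (x ≈ y) × (∀ a b → HasOrder x a → HasOrder y b → (a ∣ b) ⊎ (b ∣ a))

  InClosedNbhd : Carrier → Carrier → Set ℓ
  InClosedNbhd x z = (z ≈ x) ⊎ Adjacent x z

  SameClosedNbhd : Carrier → Carrier → Set (c ⊔ ℓ)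
  SameClosedNbhd x y = ∀ z → InClosedNbhd x z ⇔ InClosedNbhd y z

module Submission where

-- Adjacency depends only on element orders, so N[x] = N[y] says that o(x) and o(y) are
-- comparable under divisibility with exactly the same element orders; π_e(G) is closed under
-- divisors, so this is a question about a divisor-closed set of integers. If o(x) = 1 < o(y),
-- then o(y) is comparable with every element order, and two distinct primes in π_e(G) leave
-- no room for a proper multiple of o(y), so o(y) = exp(G). Otherwise, for a prime r dividing
-- o(y)/o(x), the r-part of o(y) is an element order not dividing o(x), which forces
-- o(x) = r^α and o(y) = r^β; an element of order r^α·q, q ≠ r prime, would separate them.
-- The primes dividing |G| are element orders by Cauchy's theorem, proved with McKay's
-- necklaces: rotation permutes the |G|^(p-1) p-tuples with product 1 in orbits of size p,
-- except for the constant tuples (g, …, g) with g^p = 1.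

open import Defs
open import Level using (Level)
open import Data.Nat using (ℕ; _^_; _*_; _<_; _≤_)
open import Data.Nat.Divisibility using (_∣_)
open import Data.Nat.Primality using (Prime)
open import Data.Product using (Σ; ∃; _×_)
open import Data.Sum using (_⊎_)
open import Relation.Nullary using (¬_)
open import Relation.Binary.PropositionalEquality using (_≡_; _≢_)
open import Function.Bundles using (_⇔_)
open import Algebra.Bundles using (Group)

open import Data.Product using (_,_; proj₁; proj₂)
open import Function.Construct.Composition using (_⇔-∘_)

module Arithmetic where

  open import Data.Nat
  open import Data.Nat.Properties
  open import Data.Nat.Divisibility
  open import Data.Nat.DivMod using (m≡m%n+[m/n]*n)
  open import Data.Nat.Primality
  open import Data.Nat.Primality.Factorisation using (factorise)
  open import Data.Nat.Coprimality using (Coprime; coprime-divisor; prime⇒coprime; coprime-Bézout)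
  import Data.Nat.Coprimality as Coprimality
  open import Data.Nat.GCD using (module Bézout)
  open import Data.Nat.Induction using (<-rec)
  open import Data.Nat.ListAction using (product)
  open import Data.List.Base using ([]; _∷_)
  open import Data.List.Relation.Unary.All using (_∷_)
  open import Data.Product
  open import Data.Sum using (inj₁; inj₂) renaming (map to ⊎-map)
  open import Relation.Nullary
  open import Relation.Unary using (Pred)
  open import Relation.Binary.PropositionalEquality

  private variable
    a : Level
    k m n p q r d : ℕ

  Comparable : ℕ → ℕ → Set
  Comparable m n = m ∣ n ⊎ n ∣ m

  prime>1 : Prime p → 1 < p
  prime>1 {p} pp = nonTrivial⇒n>1 p {{prime⇒nonTrivial pp}}

  prime≢1 : Prime p → p ≢ 1
  prime≢1 pp refl = <-irrefl refl (prime>1 pp)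

  prime∣prime⇒≡ : Prime p → Prime q → p ∣ q → p ≡ q
  prime∣prime⇒≡ pp pq p∣q with prime⇒irreducible pq p∣q
  ... | inj₁ p≡1 = contradiction p≡1 (prime≢1 pp)
  ... | inj₂ p≡q = p≡q

  prime∣^⇒≡ : Prime q → Prime p → ∀ n → q ∣ p ^ n → q ≡ p
  prime∣^⇒≡ pq pp zero q∣1 = contradiction (∣1⇒≡1 q∣1) (prime≢1 pq)
  prime∣^⇒≡ {p = p} pq pp (suc n) q∣p^1+n with euclidsLemma p (p ^ n) pq q∣p^1+n
  ... | inj₁ q∣p   = prime∣prime⇒≡ pq pp q∣p
  ... | inj₂ q∣p^n = prime∣^⇒≡ pq pp n q∣p^n

  m∣m^n : 1 ≤ n → m ∣ m ^ n
  m∣m^n {suc n} {m} _ = m∣m*n (m ^ n)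

  ^-monoʳ-∣ : ∀ p → m ≤ n → p ^ m ∣ p ^ n
  ^-monoʳ-∣ {m} {n} p m≤n = divides (p ^ (n ∸ m)) (begin
    p ^ n               ≡⟨ cong (p ^_) (m∸n+n≡m m≤n) ⟨
    p ^ (n ∸ m + m)     ≡⟨ ^-distribˡ-+-* p (n ∸ m) m ⟩
    p ^ (n ∸ m) * p ^ m ∎)
    where open ≡-Reasoning

  ^-comparable : ∀ p m n → Comparable (p ^ m) (p ^ n)
  ^-comparable p m n = ⊎-map (^-monoʳ-∣ p) (^-monoʳ-∣ p) (≤-total m n)

  ∣^⇒≡^ : Prime p → ∀ n → d ∣ p ^ n → ∃[ k ] k ≤ n × d ≡ p ^ k
  ∣^⇒≡^ pp zero d∣1 = 0 , z≤n , ∣1⇒≡1 d∣1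
  ∣^⇒≡^ {p} {d} pp (suc n) d∣p^1+n with p ∣? d
  ... | yes (divides e refl) =
    let instance
          p≢0 : NonZero p
          p≢0 = prime⇒nonZero pp
        (k , k≤n , e≡) = ∣^⇒≡^ pp n (*-cancelˡ-∣ p (subst (_∣ p ^ suc n) (*-comm e p) d∣p^1+n))
    in suc k , s≤s k≤n , trans (*-comm e p) (cong (p *_) e≡)
  ... | no p∤d =
    let (k , k≤n , d≡) = ∣^⇒≡^ pp n (coprime-divisor (prime∤⇒coprime pp p∤d) d∣p^1+n)
    in k , m≤n⇒m≤1+n k≤n , d≡
    where
    prime∤⇒coprime : Prime p → ¬ p ∣ d → Coprime d p
    prime∤⇒coprime pp p∤d (i∣d , i∣p) with prime⇒irreducible pp i∣p
    ... | inj₁ i≡1 = i≡1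
    ... | inj₂ refl = contradiction i∣d p∤d

  ¬^-suc∣ : .{{NonZero r}} → ∀ β {s} → ¬ r ∣ s → ¬ r ^ suc β ∣ r ^ β * s
  ¬^-suc∣ {r} β {s} r∤s r^1+β∣ = r∤s (*-cancelˡ-∣ (r ^ β) {{m^n≢0 r β}}
    (subst (_∣ r ^ β * s) (*-comm r (r ^ β)) r^1+β∣))

  PowerSplit : ℕ → ℕ → Set
  PowerSplit r k = ∃₂ λ β s → k ≡ r ^ β * s × ¬ r ∣ s

  powerSplit : 1 < r → 0 < k → PowerSplit r k
  powerSplit {r} {k} r>1 = <-rec (λ k → 0 < k → PowerSplit r k) step k
    where
    step : ∀ k → (∀ {j} → j < k → 0 < j → PowerSplit r j) → 0 < k → PowerSplit r k
    step k rec k>0 with r ∣? k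
    ... | no r∤k = 0 , k , sym (+-identityʳ k) , r∤k
    ... | yes (divides j refl) = times-r (rec (m<m*n j r {{>-nonZero j>0}} r>1) j>0)
      where
      j>0 : 0 < j
      j>0 = n≢0⇒n>0 λ { refl → <-irrefl refl k>0 }
      times-r : PowerSplit r j → PowerSplit r (j * r)
      times-r (β , s , refl , r∤s) = suc β , s , (begin
        r ^ β * s * r     ≡⟨ *-comm (r ^ β * s) r ⟩
        r * (r ^ β * s)   ≡⟨ *-assoc r (r ^ β) s ⟨
        r * r ^ β * s     ∎) , r∤s
        where open ≡-Reasoning

  ∃-prime-divisor : 1 < n → ∃[ q ] Prime q × q ∣ n
  ∃-prime-divisor {n} n>1 with factorise n {{>-nonZero (<-trans z<s n>1)}}
  ... | record { factors = [] ; isFactorisation = n≡1 } = contradiction n≡1 (>⇒≢ n>1)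
  ... | record { factors = q ∷ qs ; isFactorisation = n≡ ; factorsPrime = pq ∷ _ } =
    q , pq , divides (product qs) (trans n≡ (*-comm q (product qs)))

  ≡1⊎∃-prime-divisor : 0 < n → n ≡ 1 ⊎ ∃[ q ] Prime q × q ∣ n
  ≡1⊎∃-prime-divisor {suc zero}    _ = inj₁ refl
  ≡1⊎∃-prime-divisor {suc (suc n)} _ = inj₂ (∃-prime-divisor (s<s z<s))

  ≡^⊎∃-other-prime-divisor : Prime p → 0 < n → (∃[ k ] n ≡ p ^ k) ⊎ (∃[ q ] Prime q × q ≢ p × q ∣ n)
  ≡^⊎∃-other-prime-divisor {p} {n} pp n>0 with powerSplit (prime>1 pp) n>0
  ... | k , s , refl , p∤s with ≡1⊎∃-prime-divisor {s} (n≢0⇒n>0 λ { refl → <-irrefl (sym (*-zeroʳ (p ^ k))) n>0 })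
  ...   | inj₁ refl = inj₁ (k , *-identityʳ (p ^ k))
  ...   | inj₂ (q , pq , q∣s) = inj₂ (q , pq , (λ { refl → p∤s q∣s }) , ∣n⇒∣m*n (p ^ k) q∣s)

  -- The naturals of a subgroup of ℤ.
  record DifferenceClosed (S : Pred ℕ a) : Set a where
    field
      0∈       : S 0
      +-closed : S m → S n → S (m + n)
      ∸-closed : S (m + n) → S m → S n

    *-closed : ∀ x → S n → S (x * n)
    *-closed zero    _  = 0∈
    *-closed (suc x) Sn = +-closed Sn (*-closed x Sn)

    prime⇒1∈ : Prime p → 0 < m → m < p → S m → S p → S 1
    prime⇒1∈ {p} {m} pp m>0 m<p Sm Sp
      with coprime-Bézout (Coprimality.sym (prime⇒coprime pp {{>-nonZero m>0}} m<p))
    ... | Bézout.+- x y eq = ∸-closed (subst S (trans (sym eq) (+-comm 1 (y * p))) (*-closed x Sm)) (*-closed y Sp)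
    ... | Bézout.-+ x y eq = ∸-closed (subst S (trans (sym eq) (+-comm 1 (x * m))) (*-closed y Sp)) (*-closed x Sm)

    %-closed : ∀ {m n} .{{_ : NonZero m}} → S m → S n → S (n % m)
    %-closed {m} {n} Sm Sn = ∸-closed (subst S (trans (m≡m%n+[m/n]*n n m) (+-comm (n % m) _)) Sn) (*-closed (n / m) Sm)

module OrderSpectra where
  open Arithmetic

  open import Data.Nat
  open import Data.Nat.Properties
  open import Data.Nat.Divisibility
  open import Data.Nat.Primality
  open import Data.Product
  open import Data.Sum using (inj₁; inj₂) renaming (swap to ⊎-swap)
  open import Function.Base using (_∘_)
  open import Function.Bundles using (mk⇔; Equivalence)
  open import Function.Construct.Symmetry using (⇔-sym)
  open import Function.Construct.Identity using (⇔-id)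
  open import Relation.Nullary
  open import Relation.Unary using (Pred)
  open import Relation.Binary.PropositionalEquality

  private variable
    k m n p q r : ℕ

  comparable-^⇒≡ : ∀ {α} → Prime q → Prime r → 1 ≤ α → Comparable (r ^ α) q → q ≡ r
  comparable-^⇒≡ pq pr α≥1 (inj₁ r^α∣q) = sym (prime∣prime⇒≡ pr pq (∣-trans (m∣m^n α≥1) r^α∣q))
  comparable-^⇒≡ {α = α} pq pr α≥1 (inj₂ q∣r^α) = prime∣^⇒≡ pq pr α q∣r^α

  comparable-^-antimono : Prime p → n ≤ m → Comparable (p ^ m) k → Comparable (p ^ n) k
  comparable-^-antimono {p} pp n≤m (inj₁ p^m∣k) = inj₁ (∣-trans (^-monoʳ-∣ p n≤m) p^m∣k)
  comparable-^-antimono {p} {n} {m} pp n≤m (inj₂ k∣p^m) with ∣^⇒≡^ pp m k∣p^m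
  ... | j , _ , refl = ^-comparable p n j

  AscendingPrimePowers : ℕ → ℕ → Set
  AscendingPrimePowers a b = ∃ λ r → ∃ λ β → ∃ λ α → Prime r × 1 ≤ α × α < β × a ≡ r ^ α × b ≡ r ^ β

  module _ {s : Level} (S : Pred ℕ s) where

    IsLcm : ℕ → Set s
    IsLcm e = (∀ {k} → S k → k ∣ e) × (∀ {m} → (∀ {k} → S k → k ∣ m) → e ∣ m)

    SameComparabilities : ℕ → ℕ → Set s
    SameComparabilities a b = ∀ {k} → S k → Comparable a k ⇔ Comparable b k

    NeighbourhoodCondition : ℕ → ℕ → ℕ → Set s
    NeighbourhoodCondition a b e = (a ≡ b)
      ⊎ (((a ≡ 1) × (b ≡ e)) ⊎ ((a ≡ e) × (b ≡ 1)))
      ⊎ (∃ λ p → ∃ λ m → ∃ λ n → Prime p × 1 ≤ n × n < m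
          × (((a ≡ p ^ m) × (b ≡ p ^ n)) ⊎ ((a ≡ p ^ n) × (b ≡ p ^ m)))
          × (∀ q → Prime q → q ≢ p → ¬ S (p ^ n * q)))

  module DivisorClosed {s : Level} (S : Pred ℕ s)
    (S⇒>0 : ∀ {k} → S k → 0 < k)
    (∣-closed : ∀ {d k} → d ∣ k → S k → S d) where

    comparable-to-all⇒upper-bound : ∀ {p q b} → Prime p → Prime q → p ≢ q → S p → S q → S b → b ≢ 1 →
      (∀ {k} → S k → Comparable b k) → ∀ {k} → S k → k ∣ b
    comparable-to-all⇒upper-bound {p} {q} {b} pp pq p≢q Sp Sq Sb b≢1 comparable = k∣b
      where
      prime∈⇒∣b : ∀ {r} → Prime r → S r → r ∣ b
      prime∈⇒∣b pr Sr with comparable Sr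
      ... | inj₂ r∣b = r∣b
      ... | inj₁ b∣r with prime⇒irreducible pr b∣r
      ...   | inj₁ b≡1 = contradiction b≡1 b≢1
      ...   | inj₂ refl = ∣-refl

      no-proper-multiple : ∀ {r t} → Prime r → r ∣ t → ¬ S (t * b)
      no-proper-multiple {r} {t} pr r∣t Stb with powerSplit (prime>1 pr) (S⇒>0 Sb)
      ... | β , s , b≡ , r∤s with comparable (∣-closed (*-pres-∣ r∣t (divides s (trans b≡ (*-comm (r ^ β) s)))) Stb)
      ...   | inj₂ r^1+β∣b = ¬^-suc∣ {{prime⇒nonZero pr}} β r∤s (subst (r ^ suc β ∣_) b≡ r^1+β∣b)
      ...   | inj₁ b∣r^1+β = p≢q (trans (prime∣^⇒≡ pp pr (suc β) (∣-trans (prime∈⇒∣b pp Sp) b∣r^1+β))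
                                      (sym (prime∣^⇒≡ pq pr (suc β) (∣-trans (prime∈⇒∣b pq Sq) b∣r^1+β))))

      k∣b : ∀ {k} → S k → k ∣ b
      k∣b Sk with comparable Sk
      ... | inj₂ k∣b = k∣b
      ... | inj₁ (divides t refl) with ≡1⊎∃-prime-divisor {t} (n≢0⇒n>0 λ { refl → <-irrefl refl (S⇒>0 Sk) })
      ...   | inj₁ refl = ∣-reflexive (+-identityʳ b)
      ...   | inj₂ (r , pr , r∣t) = contradiction Sk (no-proper-multiple pr r∣t)

    proper-divisor⇒prime-powers : ∀ {a b} → S b → a ∣ b → a ≢ b → a ≢ 1 → SameComparabilities S a b →
      AscendingPrimePowers a b
    proper-divisor⇒prime-powers {a} Sb (divides t refl) a≢b a≢1 same
      with ≡1⊎∃-prime-divisor {t} (n≢0⇒n>0 λ { refl → <-irrefl refl (S⇒>0 Sb) })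
    ... | inj₁ refl = contradiction (sym (+-identityʳ a)) a≢b
    ... | inj₂ (r , pr , r∣t) with powerSplit (prime>1 pr) (S⇒>0 Sb)
    ... | β , s , b≡ , r∤s = ascending (∣^⇒≡^ pr β a∣r^β)
      where
      instance
        r≢0 : NonZero r
        r≢0 = prime⇒nonZero pr
      r^β∣b : r ^ β ∣ t * a
      r^β∣b = divides s (trans b≡ (*-comm (r ^ β) s))
      r^β∤a : ¬ r ^ β ∣ a
      r^β∤a r^β∣a = ¬^-suc∣ β r∤s (subst (r ^ suc β ∣_) b≡ (*-pres-∣ r∣t r^β∣a))
      a∣r^β : a ∣ r ^ β
      a∣r^β with Equivalence.from (same (∣-closed r^β∣b Sb)) (inj₂ r^β∣b)
      ... | inj₁ a∣r^β = a∣r^β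
      ... | inj₂ r^β∣a = contradiction r^β∣a r^β∤a
      ascending : (∃[ α ] α ≤ β × a ≡ r ^ α) → AscendingPrimePowers a (t * a)
      ascending (α , α≤β , a≡) =
        r , β , α , pr , α≥1 , α<β , a≡ , trans b≡ (trans (cong (r ^ β *_) s≡1) (*-identityʳ (r ^ β)))
        where
        α≥1 : 1 ≤ α
        α≥1 = n≢0⇒n>0 λ α≡0 → a≢1 (trans a≡ (cong (r ^_) α≡0))
        α<β : α < β
        α<β = ≤∧≢⇒< α≤β λ α≡β → r^β∤a (∣-reflexive (sym (trans a≡ (cong (r ^_) α≡β))))
        s≡1 : s ≡ 1
        s≡1 with ≡1⊎∃-prime-divisor {s}
                   (n≢0⇒n>0 λ { refl → <-irrefl (trans (sym (*-zeroʳ (r ^ β))) (sym b≡)) (S⇒>0 Sb) })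
        ... | inj₁ s≡1 = s≡1
        ... | inj₂ (q , pq , q∣s) = contradiction (subst (_∣ s) q≡r q∣s) r∤s
          where
          q∣b : q ∣ t * a
          q∣b = subst (q ∣_) (sym b≡) (∣n⇒∣m*n (r ^ β) q∣s)
          q≡r : q ≡ r
          q≡r = comparable-^⇒≡ pq pr α≥1 (subst (λ x → Comparable x q) a≡
                  (Equivalence.from (same (∣-closed q∣b Sb)) (inj₂ q∣b)))

    prime-powers⇒no-mixed-multiples : ∀ {r α β} → Prime r → α < β → SameComparabilities S (r ^ α) (r ^ β) →
      ∀ q → Prime q → q ≢ r → ¬ S (r ^ α * q)
    prime-powers⇒no-mixed-multiples {r} {α} {β} pr α<β same q pq q≢r Sr^αq
      with Equivalence.to (same Sr^αq) (inj₁ (m∣m*n q))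
    ... | inj₁ r^β∣r^αq = ¬^-suc∣ {{prime⇒nonZero pr}} α (λ r∣q → q≢r (sym (prime∣prime⇒≡ pr pq r∣q)))
                            (∣-trans (^-monoʳ-∣ r α<β) r^β∣r^αq)
    ... | inj₂ r^αq∣r^β = q≢r (prime∣^⇒≡ pq pr β (∣-trans (n∣m*n (r ^ α)) r^αq∣r^β))

    comparable-^-mono : ∀ {p m n k} → Prime p → n ≤ m → (∀ q → Prime q → q ≢ p → ¬ S (p ^ n * q)) →
      S k → Comparable (p ^ n) k → Comparable (p ^ m) k
    comparable-^-mono {p} pp n≤m no-mixed Sk (inj₂ k∣p^n) = inj₂ (∣-trans k∣p^n (^-monoʳ-∣ p n≤m))
    comparable-^-mono {p} {m} {n} pp n≤m no-mixed Sk (inj₁ (divides t refl))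
      with ≡^⊎∃-other-prime-divisor {n = t} pp (n≢0⇒n>0 λ { refl → <-irrefl refl (S⇒>0 Sk) })
    ... | inj₁ (j , refl) = subst (Comparable (p ^ m)) (^-distribˡ-+-* p j n) (^-comparable p m (j + n))
    ... | inj₂ (q , pq , q≢p , q∣t) = contradiction (∣-closed p^nq∣k Sk) (no-mixed q pq q≢p)
      where
      p^nq∣k : p ^ n * q ∣ t * p ^ n
      p^nq∣k = subst (_∣ t * p ^ n) (*-comm q (p ^ n)) (*-monoˡ-∣ (p ^ n) q∣t)

    module _ {p q e} (pp : Prime p) (pq : Prime q) (p≢q : p ≢ q) (Sp : S p) (Sq : S q) (lcm : IsLcm S e) where

      proper-divisor-cases : ∀ {a b} → S b → a ∣ b → a ≢ b → SameComparabilities S a b →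
        ((a ≡ 1) × (b ≡ e)) ⊎ AscendingPrimePowers a b
      proper-divisor-cases {a} {b} Sb a∣b a≢b same with a ≟ 1
      ... | no a≢1 = inj₂ (proper-divisor⇒prime-powers Sb a∣b a≢b a≢1 same)
      ... | yes refl = inj₁ (refl , ∣-antisym (proj₁ lcm Sb) (proj₂ lcm k∣b))
        where
        k∣b : ∀ {k} → S k → k ∣ b
        k∣b = comparable-to-all⇒upper-bound pp pq p≢q Sp Sq Sb (λ b≡1 → a≢b (sym b≡1))
                (λ Sk → Equivalence.to (same Sk) (inj₁ (1∣ _)))

      sameComparabilities⇔condition : ∀ {a b} → S a → S b →
        SameComparabilities S a b ⇔ NeighbourhoodCondition S a b e
      sameComparabilities⇔condition {a} {b} Sa Sb = mk⇔ forward backward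
        where
        forward : SameComparabilities S a b → NeighbourhoodCondition S a b e
        forward same with a ≟ b | ⊎-swap (Equivalence.to (same Sa) (inj₁ ∣-refl))
        ... | yes a≡b | _ = inj₁ a≡b
        ... | no a≢b | inj₁ a∣b with proper-divisor-cases Sb a∣b a≢b same
        ...   | inj₁ a≡1∧b≡e = inj₂ (inj₁ (inj₁ a≡1∧b≡e))
        ...   | inj₂ (r , β , α , pr , α≥1 , α<β , refl , refl) =
                inj₂ (inj₂ (r , β , α , pr , α≥1 , α<β , inj₂ (refl , refl) ,
                  prime-powers⇒no-mixed-multiples pr α<β same))
        forward same | no a≢b | inj₂ b∣a with proper-divisor-cases Sa b∣a (a≢b ∘ sym) (⇔-sym ∘ same)
        ...   | inj₁ (b≡1 , a≡e) = inj₂ (inj₁ (inj₂ (a≡e , b≡1)))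
        ...   | inj₂ (r , β , α , pr , α≥1 , α<β , refl , refl) =
                inj₂ (inj₂ (r , β , α , pr , α≥1 , α<β , inj₁ (refl , refl) ,
                  prime-powers⇒no-mixed-multiples pr α<β (⇔-sym ∘ same)))

        backward : NeighbourhoodCondition S a b e → SameComparabilities S a b
        backward (inj₁ refl) _ = ⇔-id _
        backward (inj₂ (inj₁ (inj₁ (refl , refl)))) Sk = mk⇔ (λ _ → inj₂ (proj₁ lcm Sk)) (λ _ → inj₁ (1∣ _))
        backward (inj₂ (inj₁ (inj₂ (refl , refl)))) Sk = mk⇔ (λ _ → inj₁ (1∣ _)) (λ _ → inj₂ (proj₁ lcm Sk))
        backward (inj₂ (inj₂ (p , m , n , pp , _ , n<m , inj₁ (refl , refl) , no-mixed))) Sk =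
          mk⇔ (comparable-^-antimono pp (<⇒≤ n<m)) (comparable-^-mono pp (<⇒≤ n<m) no-mixed Sk)
        backward (inj₂ (inj₂ (p , m , n , pp , _ , n<m , inj₂ (refl , refl) , no-mixed))) Sk =
          mk⇔ (comparable-^-mono pp (<⇒≤ n<m) no-mixed Sk) (comparable-^-antimono pp (<⇒≤ n<m))

module Counting where

  open import Data.Nat
  open import Data.Nat.Properties
  open import Data.Fin using (Fin; zero; suc)
  import Data.Fin.Properties as Fin
  open import Data.List using (List; []; _∷_; _++_; _∷ʳ_; [_]; length; replicate)
  open import Data.List.Properties using (length-++; ++-assoc; ++-identityʳ; ∷-injective; ∷ʳ-injective; ≡-dec)
  open import Data.Product
  open import Data.Empty using (⊥-elim)
  open import Function.Base using (_∘_; id)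
  import Function.Endo.Propositional as Endo
  open import Relation.Nullary
  open import Relation.Binary.PropositionalEquality hiding ([_])
  open import Algebra.Properties.CommutativeMonoid.Sum +-0-commutativeMonoid
    using (sum-syntax; ∑-distrib-+; ∑-comm; sum-cong-≗)

  private variable
    a : Level
    P Q : Set a

  indicator : Dec P → ℕ
  indicator (yes _) = 1
  indicator (no _)  = 0

  indicator-yes : (P? : Dec P) → P → indicator P? ≡ 1
  indicator-yes (yes _) _ = refl
  indicator-yes (no ¬p) p = ⊥-elim (¬p p)

  indicator-no : (P? : Dec P) → ¬ P → indicator P? ≡ 0
  indicator-no (yes p) ¬p = ⊥-elim (¬p p)
  indicator-no (no _)  _  = refl

  indicator-⇔ : (P? : Dec P) (Q? : Dec Q) → (P → Q) → (Q → P) → indicator P? ≡ indicator Q?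
  indicator-⇔ (yes p) Q? P→Q _ = sym (indicator-yes Q? (P→Q p))
  indicator-⇔ (no ¬p) Q? _ Q→P = sym (indicator-no Q? (¬p ∘ Q→P))

  indicator-split : (P? : Dec P) (Q? : Dec Q) → indicator P? ≡ indicator (P? ×-dec Q?) + indicator (P? ×-dec ¬? Q?)
  indicator-split (yes _) (yes _) = refl
  indicator-split (yes _) (no _)  = refl
  indicator-split (no _)  _       = refl

  indicator≢0⇒ : (P? : Dec P) → indicator P? ≢ 0 → P
  indicator≢0⇒ (yes p) _ = p
  indicator≢0⇒ (no _)  i≢0 = ⊥-elim (i≢0 refl)

  ∑-const : ∀ n c → ∑[ i < n ] c ≡ n * c
  ∑-const zero    c = refl
  ∑-const (suc n) c = cong (c +_) (∑-const n c)

  ∑-indicator-none : ∀ {n} {P : Fin n → Set a} (P? : ∀ i → Dec (P i)) → (∀ i → ¬ P i) →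
    ∑[ i < n ] indicator (P? i) ≡ 0
  ∑-indicator-none {n = n} P? ¬P = begin
    ∑[ i < n ] indicator (P? i) ≡⟨ sum-cong-≗ (λ i → indicator-no (P? i) (¬P i)) ⟩
    ∑[ i < n ] 0                ≡⟨ ∑-const n 0 ⟩
    n * 0                       ≡⟨ *-zeroʳ n ⟩
    0                           ∎
    where open ≡-Reasoning

  ∑-indicator-unique : ∀ {n} {P : Fin n → Set a} (P? : ∀ i → Dec (P i)) {i₀} →
    P i₀ → (∀ i → P i → i ≡ i₀) → ∑[ i < n ] indicator (P? i) ≡ 1
  ∑-indicator-unique P? {zero} p₀ unique = cong₂ _+_ (indicator-yes (P? zero) p₀)
    (∑-indicator-none (P? ∘ suc) λ i p → Fin.0≢1+n (sym (unique (suc i) p)))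
  ∑-indicator-unique P? {suc i₀} p₀ unique = cong₂ _+_ (indicator-no (P? zero) λ p → Fin.0≢1+n (unique zero p))
    (∑-indicator-unique (P? ∘ suc) p₀ λ i p → Fin.suc-injective (unique (suc i) p))

  ∑≢0⇒∃≢0 : ∀ {n} (f : Fin n → ℕ) → ∑[ i < n ] f i ≢ 0 → ∃[ i ] f i ≢ 0
  ∑≢0⇒∃≢0 {zero}  f ∑≢0 = ⊥-elim (∑≢0 refl)
  ∑≢0⇒∃≢0 {suc n} f ∑≢0 with f zero ≟ 0
  ... | no f₀≢0 = zero , f₀≢0
  ... | yes f₀≡0 = map suc id (∑≢0⇒∃≢0 (f ∘ suc) λ ∑≡0 → ∑≢0 (cong₂ _+_ f₀≡0 ∑≡0))

  module Tuples (N : ℕ) where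

    _≟ᵗ_ : (l m : List (Fin N)) → Dec (l ≡ m)
    _≟ᵗ_ = ≡-dec Fin._≟_

    sumTuples : ℕ → (List (Fin N) → ℕ) → ℕ
    sumTuples zero    f = f []
    sumTuples (suc k) f = ∑[ i < N ] sumTuples k (f ∘ (i ∷_))

    count : ∀ {a} {P : List (Fin N) → Set a} → ℕ → (∀ l → Dec (P l)) → ℕ
    count k P? = sumTuples k (indicator ∘ P?)

    sumTuples-cong : ∀ k {f g} → (∀ l → length l ≡ k → f l ≡ g l) → sumTuples k f ≡ sumTuples k g
    sumTuples-cong zero    f≗g = f≗g [] refl
    sumTuples-cong (suc k) f≗g = sum-cong-≗ λ i → sumTuples-cong k λ l ∣l∣≡k → f≗g (i ∷ l) (cong suc ∣l∣≡k)

    sumTuples-distrib-+ : ∀ k f g → sumTuples k (λ l → f l + g l) ≡ sumTuples k f + sumTuples k g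
    sumTuples-distrib-+ zero    f g = refl
    sumTuples-distrib-+ (suc k) f g = trans (sum-cong-≗ λ i → sumTuples-distrib-+ k (f ∘ (i ∷_)) (g ∘ (i ∷_)))
      (∑-distrib-+ (λ i → sumTuples k (f ∘ (i ∷_))) (λ i → sumTuples k (g ∘ (i ∷_))))

    count-split : ∀ {a b} {P : List (Fin N) → Set a} {Q : List (Fin N) → Set b} k
      (P? : ∀ l → Dec (P l)) (Q? : ∀ l → Dec (Q l)) →
      count k P? ≡ count k (λ l → P? l ×-dec Q? l) + count k (λ l → P? l ×-dec ¬? (Q? l))
    count-split k P? Q? = trans (sumTuples-cong k λ l _ → indicator-split (P? l) (Q? l))
      (sumTuples-distrib-+ k (λ l → indicator (P? l ×-dec Q? l)) (λ l → indicator (P? l ×-dec ¬? (Q? l))))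

    sumTuples-const : ∀ k c → sumTuples k (λ _ → c) ≡ N ^ k * c
    sumTuples-const zero    c = sym (+-identityʳ c)
    sumTuples-const (suc k) c = begin
      ∑[ i < N ] sumTuples k (λ _ → c) ≡⟨ sum-cong-≗ {N} (λ _ → sumTuples-const k c) ⟩
      ∑[ i < N ] (N ^ k * c)           ≡⟨ ∑-const N (N ^ k * c) ⟩
      N * (N ^ k * c)                  ≡⟨ *-assoc N (N ^ k) c ⟨
      N * N ^ k * c                    ∎
      where open ≡-Reasoning

    ∑-sumTuples-comm : ∀ k {n} (f : Fin n → List (Fin N) → ℕ) →
      ∑[ j < n ] sumTuples k (f j) ≡ sumTuples k (λ l → ∑[ j < n ] f j l)
    ∑-sumTuples-comm zero    f = refl
    ∑-sumTuples-comm (suc k) f = trans (∑-comm λ j i → sumTuples k (f j ∘ (i ∷_)))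
      (sum-cong-≗ λ i → ∑-sumTuples-comm k λ j l → f j (i ∷ l))

    sumTuples-suc-last : ∀ k f → sumTuples (suc k) f ≡ sumTuples k (λ l → ∑[ i < N ] f (l ∷ʳ i))
    sumTuples-suc-last zero    f = refl
    sumTuples-suc-last (suc k) f = sum-cong-≗ λ i → sumTuples-suc-last k (f ∘ (i ∷_))

    sumTuples-indicator-≡ : ∀ k u → length u ≡ k → sumTuples k (λ l → indicator (l ≟ᵗ u)) ≡ 1
    sumTuples-indicator-≡ zero    []      _ = refl
    sumTuples-indicator-≡ (suc k) (a ∷ u) ∣u∣≡k =
      trans (sum-cong-≗ head-term) (∑-indicator-unique {P = _≡ a} (Fin._≟ a) refl λ _ → id)
      where
      head-term : ∀ i → sumTuples k (λ l → indicator ((i ∷ l) ≟ᵗ (a ∷ u))) ≡ indicator (i Fin.≟ a)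
      head-term i with i Fin.≟ a
      ... | yes refl = trans (sumTuples-cong k λ l _ → indicator-⇔ _ (l ≟ᵗ u) (proj₂ ∘ ∷-injective) (cong (a ∷_)))
                             (sumTuples-indicator-≡ k u (suc-injective ∣u∣≡k))
      -- The heads differ, so the decision computes to no.
      ... | no i≢a = trans (sumTuples-cong k {g = λ _ → 0} λ _ _ → refl)
                           (trans (sumTuples-const k 0) (*-zeroʳ (N ^ k)))

    sumTuples≢0⇒∃≢0 : ∀ k f → sumTuples k f ≢ 0 → ∃[ l ] length l ≡ k × f l ≢ 0
    sumTuples≢0⇒∃≢0 zero    f f[]≢0 = [] , refl , f[]≢0
    sumTuples≢0⇒∃≢0 (suc k) f ∑≢0 with ∑≢0⇒∃≢0 _ ∑≢0
    ... | i , ∑ᵢ≢0 with sumTuples≢0⇒∃≢0 k (f ∘ (i ∷_)) ∑ᵢ≢0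
    ...   | l , ∣l∣≡k , fᵢₗ≢0 = i ∷ l , cong suc ∣l∣≡k , fᵢₗ≢0

  module Rotation {A : Set a} where

    open Endo (List A) using (^-homo) renaming (_^_ to _^ᶠ_)

    rotate : List A → List A
    rotate []      = []
    rotate (x ∷ l) = l ∷ʳ x

    rotate-injective : ∀ {l m} → rotate l ≡ rotate m → l ≡ m
    rotate-injective {[]}    {[]}        _ = refl
    rotate-injective {[]}    {_ ∷ []}    ()
    rotate-injective {[]}    {_ ∷ _ ∷ _} ()
    rotate-injective {_ ∷ []}    {[]} ()
    rotate-injective {_ ∷ _ ∷ _} {[]} ()
    rotate-injective {x ∷ l} {y ∷ m} eq with ∷ʳ-injective l m eq
    ... | refl , refl = refl

    length-rotate : ∀ l → length (rotate l) ≡ length l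
    length-rotate []      = refl
    length-rotate (x ∷ l) = trans (length-++ l) (+-comm (length l) 1)

    length-rotate^ : ∀ j l → length ((rotate ^ᶠ j) l) ≡ length l
    length-rotate^ zero    l = refl
    length-rotate^ (suc j) l = trans (length-rotate ((rotate ^ᶠ j) l)) (length-rotate^ j l)

    rotate^-injective : ∀ j {l m} → (rotate ^ᶠ j) l ≡ (rotate ^ᶠ j) m → l ≡ m
    rotate^-injective zero    eq = eq
    rotate^-injective (suc j) eq = rotate^-injective j (rotate-injective eq)

    rotate^-suc : ∀ j l → (rotate ^ᶠ suc j) l ≡ (rotate ^ᶠ j) (rotate l)
    rotate^-suc j l = cong (λ f → f l) (trans (cong (rotate ^ᶠ_) (+-comm 1 j)) (^-homo rotate j 1))

    rotate^-+ : ∀ m n l → (rotate ^ᶠ (m + n)) l ≡ (rotate ^ᶠ m) ((rotate ^ᶠ n) l)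
    rotate^-+ m n l = cong (λ f → f l) (^-homo rotate m n)

    rotate^-++ : ∀ u w → (rotate ^ᶠ length u) (u ++ w) ≡ w ++ u
    rotate^-++ []      w = sym (++-identityʳ w)
    rotate^-++ (x ∷ u) w = begin
      (rotate ^ᶠ suc (length u)) (x ∷ u ++ w) ≡⟨ rotate^-suc (length u) _ ⟩
      (rotate ^ᶠ length u) ((u ++ w) ∷ʳ x)    ≡⟨ cong (rotate ^ᶠ length u) (++-assoc u w [ x ]) ⟩
      (rotate ^ᶠ length u) (u ++ w ∷ʳ x)      ≡⟨ rotate^-++ u (w ∷ʳ x) ⟩
      w ∷ʳ x ++ u                             ≡⟨ ++-assoc w [ x ] u ⟩
      w ++ x ∷ u                              ∎
      where open ≡-Reasoning

    rotate^-length : ∀ l → (rotate ^ᶠ length l) l ≡ l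
    rotate^-length l = trans (cong (rotate ^ᶠ length l) (sym (++-identityʳ l))) (rotate^-++ l [])

    rotate-fixed⇒replicate : ∀ x t → rotate (x ∷ t) ≡ x ∷ t → t ≡ replicate (length t) x
    rotate-fixed⇒replicate x []      _ = refl
    rotate-fixed⇒replicate x (y ∷ t) fixed with ∷-injective fixed
    ... | refl , t∷ʳx≡x∷t = cong (x ∷_) (rotate-fixed⇒replicate x t t∷ʳx≡x∷t)

    rotate-replicate : ∀ n x → rotate (replicate n x) ≡ replicate n x
    rotate-replicate zero          x = refl
    rotate-replicate (suc zero)    x = refl
    rotate-replicate (suc (suc n)) x = cong (x ∷_) (rotate-replicate (suc n) x)

module Necklaces {N p : ℕ} (pp : Prime p) where
  open Arithmetic
  open Counting
  open import Data.Nat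
  open import Data.Nat.Properties
  open import Data.Nat.Divisibility
  open import Data.Nat.DivMod using (m≡m%n+[m/n]*n; m%n<n)
  open import Data.Nat.Primality
  open import Data.Nat.Induction using (<-rec)
  open import Data.Fin using (Fin; toℕ; fromℕ<)
  import Data.Fin.Properties as Fin
  open import Data.List using (List; length)
  open import Data.Product
  open import Data.Empty using (⊥-elim)
  open import Function.Base using (_∘_)
  import Function.Endo.Propositional as Endo
  open import Level using () renaming (suc to lsuc)
  open import Relation.Nullary
  open import Relation.Binary.Definitions using (tri<; tri≈; tri>)
  open import Relation.Unary using (Pred)
  open import Relation.Binary.PropositionalEquality hiding ([_])
  open import Algebra.Properties.CommutativeMonoid.Sum +-0-commutativeMonoid using (sum-syntax; sum-cong-≗)
  open Tuples N
  open Rotation {A = Fin N}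
  open Endo (List (Fin N)) using () renaming (_^_ to _^ᶠ_)

  private instance
    p≢0 : NonZero p
    p≢0 = prime⇒nonZero pp

  record RotationClosed ℓ : Set (lsuc ℓ) where
    field
      Q             : Pred (List (Fin N)) ℓ
      Q?            : ∀ l → Dec (Q l)
      rotate-closed : ∀ {l} → Q l → Q (rotate l)

    rotate^-closed : ∀ j {l} → Q l → Q ((rotate ^ᶠ j) l)
    rotate^-closed zero    q = q
    rotate^-closed (suc j) q = rotate-closed (rotate^-closed j q)

    NonFixed : Pred (List (Fin N)) ℓ
    NonFixed l = Q l × ¬ rotate l ≡ l

    NonFixed? : ∀ l → Dec (NonFixed l)
    NonFixed? l = Q? l ×-dec ¬? (rotate l ≟ᵗ l)

    countNonFixed : ℕ
    countNonFixed = count p NonFixed?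

  module Orbit (v : List (Fin N)) (∣v∣≡p : length v ≡ p) (v-nonfixed : ¬ rotate v ≡ v) where

    periods : DifferenceClosed (λ j → (rotate ^ᶠ j) v ≡ v)
    periods = record
      { 0∈       = refl
      ; +-closed = λ {m} {n} m-period n-period → trans (rotate^-+ m n v) (trans (cong (rotate ^ᶠ m) n-period) m-period)
      ; ∸-closed = λ {m} {n} m+n-period m-period → begin
          (rotate ^ᶠ n) v                   ≡⟨ cong (rotate ^ᶠ n) m-period ⟨
          (rotate ^ᶠ n) ((rotate ^ᶠ m) v)   ≡⟨ rotate^-+ n m v ⟨
          (rotate ^ᶠ (n + m)) v             ≡⟨ cong (λ j → (rotate ^ᶠ j) v) (+-comm n m) ⟩
          (rotate ^ᶠ (m + n)) v             ≡⟨ m+n-period ⟩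
          v                                 ∎
      }
      where open ≡-Reasoning
    open DifferenceClosed periods

    p-period : (rotate ^ᶠ p) v ≡ v
    p-period = subst (λ j → (rotate ^ᶠ j) v ≡ v) ∣v∣≡p (rotate^-length v)

    rotate^-mod : ∀ j → (rotate ^ᶠ j) v ≡ (rotate ^ᶠ (j % p)) v
    rotate^-mod j = begin
      (rotate ^ᶠ j) v                                     ≡⟨ cong (λ i → (rotate ^ᶠ i) v) (m≡m%n+[m/n]*n j p) ⟩
      (rotate ^ᶠ (j % p + j / p * p)) v                   ≡⟨ rotate^-+ (j % p) (j / p * p) v ⟩
      (rotate ^ᶠ (j % p)) ((rotate ^ᶠ (j / p * p)) v)     ≡⟨ cong (rotate ^ᶠ (j % p)) (*-closed (j / p) p-period) ⟩
      (rotate ^ᶠ (j % p)) v                               ∎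
      where open ≡-Reasoning

    rotations-distinct : ∀ {i j} → i < j → j < p → ¬ (rotate ^ᶠ i) v ≡ (rotate ^ᶠ j) v
    rotations-distinct {i} {j} i<j j<p eq =
      v-nonfixed (prime⇒1∈ pp (m<n⇒0<n∸m i<j) (≤-<-trans (m∸n≤m j i) j<p) [j∸i]-period p-period)
      where
      [j∸i]-period : (rotate ^ᶠ (j ∸ i)) v ≡ v
      [j∸i]-period = rotate^-injective i (begin
        (rotate ^ᶠ i) ((rotate ^ᶠ (j ∸ i)) v) ≡⟨ rotate^-+ i (j ∸ i) v ⟨
        (rotate ^ᶠ (i + (j ∸ i))) v           ≡⟨ cong (λ k → (rotate ^ᶠ k) v) (m+[n∸m]≡n (<⇒≤ i<j)) ⟩
        (rotate ^ᶠ j) v                       ≡⟨ eq ⟨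
        (rotate ^ᶠ i) v                       ∎)
        where open ≡-Reasoning

    rotations-injective : ∀ {i j : Fin p} → (rotate ^ᶠ toℕ i) v ≡ (rotate ^ᶠ toℕ j) v → i ≡ j
    rotations-injective {i} {j} eq with <-cmp (toℕ i) (toℕ j)
    ... | tri< i<j _ _ = ⊥-elim (rotations-distinct i<j (Fin.toℕ<n j) eq)
    ... | tri≈ _ i≡j _ = Fin.toℕ-injective i≡j
    ... | tri> _ _ j<i = ⊥-elim (rotations-distinct j<i (Fin.toℕ<n i) (sym eq))

    InOrbit : Pred (List (Fin N)) _
    InOrbit l = ∃[ i ] l ≡ (rotate ^ᶠ toℕ {p} i) v

    InOrbit? : ∀ l → Dec (InOrbit l)
    InOrbit? l = Fin.any? λ i → l ≟ᵗ (rotate ^ᶠ toℕ i) v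

    inOrbit : ∀ j → InOrbit ((rotate ^ᶠ j) v)
    inOrbit j = fromℕ< (m%n<n j p) ,
      trans (rotate^-mod j) (cong (λ i → (rotate ^ᶠ i) v) (sym (Fin.toℕ-fromℕ< (m%n<n j p))))

    inOrbit-rotate⁻¹ : ∀ {l} → InOrbit (rotate l) → InOrbit l
    inOrbit-rotate⁻¹ {l} (i , rotate-l≡) = subst InOrbit (rotate-injective (begin
      rotate ((rotate ^ᶠ (toℕ i + pred p)) v) ≡⟨ cong (λ k → (rotate ^ᶠ k) v) (+-suc (toℕ i) (pred p)) ⟨
      (rotate ^ᶠ (toℕ i + suc (pred p))) v    ≡⟨ cong (λ k → (rotate ^ᶠ (toℕ i + k)) v) (suc-pred p) ⟩
      (rotate ^ᶠ (toℕ i + p)) v               ≡⟨ rotate^-+ (toℕ i) p v ⟩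
      (rotate ^ᶠ toℕ i) ((rotate ^ᶠ p) v)     ≡⟨ cong (rotate ^ᶠ toℕ i) p-period ⟩
      (rotate ^ᶠ toℕ i) v                     ≡⟨ rotate-l≡ ⟨
      rotate l                                ∎)) (inOrbit (toℕ i + pred p))
      where open ≡-Reasoning

    orbit-size : count p InOrbit? ≡ p
    orbit-size = begin
      count p InOrbit?
        ≡⟨ sumTuples-cong p (λ l _ → indicator-InOrbit l) ⟩
      sumTuples p (λ l → ∑[ i < p ] indicator (l ≟ᵗ orbitPoint i))
        ≡⟨ ∑-sumTuples-comm p (λ i l → indicator (l ≟ᵗ orbitPoint i)) ⟨
      ∑[ i < p ] count p (_≟ᵗ orbitPoint i)
        ≡⟨ sum-cong-≗ {p} (λ i → sumTuples-indicator-≡ p (orbitPoint i) (trans (length-rotate^ (toℕ i) v) ∣v∣≡p)) ⟩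
      ∑[ i < p ] 1
        ≡⟨ ∑-const p 1 ⟩
      p * 1
        ≡⟨ *-identityʳ p ⟩
      p ∎
      where
      open ≡-Reasoning
      orbitPoint : Fin p → List (Fin N)
      orbitPoint i = (rotate ^ᶠ toℕ i) v
      indicator-InOrbit : ∀ l → indicator (InOrbit? l) ≡ ∑[ i < p ] indicator (l ≟ᵗ orbitPoint i)
      indicator-InOrbit l with InOrbit? l
      ... | yes (i , l≡) = sym (∑-indicator-unique (λ j → l ≟ᵗ orbitPoint j) {i} l≡
                                 λ j l≡′ → rotations-injective (trans (sym l≡′) l≡))
      ... | no ∉orbit = sym (∑-indicator-none (λ j → l ≟ᵗ orbitPoint j) λ j l≡ → ∉orbit (j , l≡))

  module _ {ℓ} (I : RotationClosed ℓ) (v : List (Fin N)) (∣v∣≡p : length v ≡ p)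
           (v-nonFixed : RotationClosed.NonFixed I v) where
    open RotationClosed I
    open Orbit v ∣v∣≡p (proj₂ v-nonFixed)

    withoutOrbit : RotationClosed ℓ
    withoutOrbit = record
      { Q             = λ l → Q l × ¬ InOrbit l
      ; Q?            = λ l → Q? l ×-dec ¬? (InOrbit? l)
      ; rotate-closed = λ (q , ∉orbit) → rotate-closed q , ∉orbit ∘ inOrbit-rotate⁻¹
      }

    orbit⊆nonFixed : ∀ {l} → InOrbit l → NonFixed l
    orbit⊆nonFixed (i , refl) = rotate^-closed (toℕ i) (proj₁ v-nonFixed) , λ fixed →
      proj₂ v-nonFixed (rotate^-injective (toℕ i) (trans (sym (rotate^-suc (toℕ i) v)) fixed))

    countNonFixed-withoutOrbit : countNonFixed ≡ RotationClosed.countNonFixed withoutOrbit + p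
    countNonFixed-withoutOrbit = begin
      countNonFixed
        ≡⟨ sumTuples-cong p (λ l _ → split-by-orbit l) ⟩
      sumTuples p (λ l → indicator (NonFixed′? l) + indicator (InOrbit? l))
        ≡⟨ sumTuples-distrib-+ p (indicator ∘ NonFixed′?) (indicator ∘ InOrbit?) ⟩
      remaining + count p InOrbit?
        ≡⟨ cong (remaining +_) orbit-size ⟩
      remaining + p ∎
      where
      open ≡-Reasoning
      open RotationClosed withoutOrbit using () renaming (NonFixed? to NonFixed′?; countNonFixed to remaining)
      split-by-orbit : ∀ l → indicator (NonFixed? l) ≡ indicator (NonFixed′? l) + indicator (InOrbit? l)
      split-by-orbit l with InOrbit? l
      ... | yes o = trans (indicator-yes _ (orbit⊆nonFixed o))
                          (cong (_+ 1) (sym (indicator-no _ λ ((_ , ∉orbit) , _) → ∉orbit o)))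
      ... | no ∉orbit = trans (indicator-⇔ _ _ (λ (q , nf) → (q , ∉orbit) , nf) (λ ((q , _) , nf) → q , nf))
                              (sym (+-identityʳ _))

  p∣countNonFixed : ∀ {ℓ} (I : RotationClosed ℓ) → p ∣ RotationClosed.countNonFixed I
  p∣countNonFixed {ℓ} I = <-rec (λ n → ∀ I → RotationClosed.countNonFixed I ≡ n → p ∣ n) step _ I refl
    where
    step : ∀ n → (∀ {m} → m < n → ∀ I → RotationClosed.countNonFixed I ≡ m → p ∣ m) →
           ∀ I → RotationClosed.countNonFixed I ≡ n → p ∣ n
    step zero    _   _ _ = p ∣0
    step (suc n) rec I count≡1+n =
      removeOrbit (sumTuples≢0⇒∃≢0 p _ λ count≡0 → 0≢1+n (trans (sym count≡0) count≡1+n))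
      where
      open RotationClosed I using (NonFixed; NonFixed?)
      removeOrbit : (∃[ v ] length v ≡ p × indicator (NonFixed? v) ≢ 0) → p ∣ suc n
      removeOrbit (v , ∣v∣≡p , indicator≢0) =
        subst (p ∣_) (trans (sym split) count≡1+n) (∣m∣n⇒∣m+n (rec remaining<1+n I′ refl) ∣-refl)
        where
        v-nonFixed : NonFixed v
        v-nonFixed = indicator≢0⇒ (NonFixed? v) indicator≢0
        I′ : RotationClosed ℓ
        I′ = withoutOrbit I v ∣v∣≡p v-nonFixed
        remaining : ℕ
        remaining = RotationClosed.countNonFixed I′
        split : RotationClosed.countNonFixed I ≡ remaining + p
        split = countNonFixed-withoutOrbit I v ∣v∣≡p v-nonFixed
        remaining<1+n : remaining < suc n
        remaining<1+n = subst (remaining <_) (trans (sym split) count≡1+n) (m<m+n remaining (>-nonZero⁻¹ p))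

module GroupOrders {c ℓ : Level} (G : Group c ℓ) where
  open Arithmetic
  open OrderSpectra
  open import Data.Nat
  open import Data.Nat.Properties
  open import Data.Nat.Divisibility
  open import Data.Nat.DivMod using (m%n<n)
  open import Data.Fin using (Fin)
  import Data.Fin.Properties as Fin
  open import Data.Product
  open import Data.Sum using (inj₁; inj₂)
  open import Function.Bundles using (mk⇔; Equivalence; Bijection)
  open import Relation.Nullary
  open import Relation.Binary.Definitions using (Decidable)
  open import Relation.Binary.PropositionalEquality as ≡ using (_≡_)
  open Group G
  open import Relation.Binary.Reasoning.Setoid setoid

  pow-+ : ∀ x m n → pow G x (m + n) ≈ pow G x m ∙ pow G x n
  pow-+ x zero    n = sym (identityˡ _)
  pow-+ x (suc m) n = trans (∙-congˡ (pow-+ x m n)) (sym (assoc _ _ _))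

  pow-* : ∀ x m n → pow G x (m * n) ≈ pow G (pow G x n) m
  pow-* x zero    n = refl
  pow-* x (suc m) n = trans (pow-+ x n (m * n)) (∙-congˡ (pow-* x m n))

  pow-congˡ : ∀ {x y} n → x ≈ y → pow G x n ≈ pow G y n
  pow-congˡ zero    x≈y = refl
  pow-congˡ (suc n) x≈y = ∙-cong x≈y (pow-congˡ n x≈y)

  ε-pow : ∀ n → pow G ε n ≈ ε
  ε-pow zero    = refl
  ε-pow (suc n) = trans (identityˡ _) (ε-pow n)

  annihilators : ∀ x → DifferenceClosed (λ n → pow G x n ≈ ε)
  annihilators x = record
    { 0∈       = refl
    ; +-closed = λ {m} {n} xᵐ≈ε xⁿ≈ε → begin
        pow G x (m + n)         ≈⟨ pow-+ x m n ⟩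
        pow G x m ∙ pow G x n   ≈⟨ ∙-cong xᵐ≈ε xⁿ≈ε ⟩
        ε ∙ ε                   ≈⟨ identityˡ ε ⟩
        ε                       ∎
    ; ∸-closed = λ {m} {n} xᵐ⁺ⁿ≈ε xᵐ≈ε → begin
        pow G x n               ≈⟨ identityˡ _ ⟨
        ε ∙ pow G x n           ≈⟨ ∙-congʳ xᵐ≈ε ⟨
        pow G x m ∙ pow G x n   ≈⟨ pow-+ x m n ⟨
        pow G x (m + n)         ≈⟨ xᵐ⁺ⁿ≈ε ⟩
        ε                       ∎
    }

  module _ {x k} (order : HasOrder G x k) where
    private
      instance
        k≢0 : NonZero k
        k≢0 = >-nonZero (proj₁ order)
      open DifferenceClosed (annihilators x)

    order-∣⇒pow≈ε : ∀ {n} → k ∣ n → pow G x n ≈ ε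
    order-∣⇒pow≈ε (divides q ≡.refl) = *-closed q (proj₁ (proj₂ order))

    pow≈ε⇒order-∣ : ∀ {n} → pow G x n ≈ ε → k ∣ n
    pow≈ε⇒order-∣ {n} xⁿ≈ε with n % k in n%k≡r
    ... | zero  = m%n≡0⇒n∣m n k n%k≡r
    ... | suc r = contradiction (≡.subst (λ i → pow G x i ≈ ε) n%k≡r (%-closed (proj₁ (proj₂ order)) xⁿ≈ε))
                    (proj₂ (proj₂ order) (suc r) (s≤s z≤n) (≡.subst (_< k) n%k≡r (m%n<n n k)))

  order-unique : ∀ {x m n} → HasOrder G x m → HasOrder G x n → m ≡ n
  order-unique oₘ oₙ =
    ∣-antisym (pow≈ε⇒order-∣ oₘ (proj₁ (proj₂ oₙ))) (pow≈ε⇒order-∣ oₙ (proj₁ (proj₂ oₘ)))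

  hasOrder-cong : ∀ {x y k} → x ≈ y → HasOrder G x k → HasOrder G y k
  hasOrder-cong {k = k} x≈y (k≥1 , xᵏ≈ε , minimal) =
    k≥1 , trans (pow-congˡ k (sym x≈y)) xᵏ≈ε ,
    λ j j≥1 j<k yʲ≈ε → minimal j j≥1 j<k (trans (pow-congˡ j x≈y) yʲ≈ε)

  inSpectrum⇒>0 : ∀ {k} → InSpectrum G k → 0 < k
  inSpectrum⇒>0 (_ , k≥1 , _) = k≥1

  inSpectrum-∣-closed : ∀ {d k} → d ∣ k → InSpectrum G k → InSpectrum G d
  inSpectrum-∣-closed {d} (divides m ≡.refl) (x , order@(md≥1 , _ , _)) = pow G x m , d≥1 , xᵐᵈ≈ε , minimal
    where
    md≢0 : NonZero (m * d)
    md≢0 = >-nonZero md≥1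
    d≥1 : 1 ≤ d
    d≥1 = >-nonZero⁻¹ d {{m*n≢0⇒n≢0 m {{md≢0}}}}
    xᵐᵈ≈ε : pow G (pow G x m) d ≈ ε
    xᵐᵈ≈ε = trans (sym (pow-* x d m)) (order-∣⇒pow≈ε order (∣-reflexive (*-comm m d)))
    minimal : ∀ j → 1 ≤ j → j < d → ¬ pow G (pow G x m) j ≈ ε
    minimal j j≥1 j<d xᵐʲ≈ε = <⇒≱ j<d (∣⇒≤ {{>-nonZero j≥1}}
      (*-cancelʳ-∣ m {{m*n≢0⇒m≢0 m {{md≢0}}}}
        (≡.subst (_∣ j * m) (*-comm m d) (pow≈ε⇒order-∣ order (trans (pow-* x j m) xᵐʲ≈ε)))))

  ≈-decidable : ∀ {N} → HasCardinality G N → Decidable _≈_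
  ≈-decidable {N} card x y = map′
    (λ index≡ → trans (sym (index↦ x)) (trans (reflexive (≡.cong to index≡)) (index↦ y)))
    (λ x≈y → injective (trans (index↦ x) (trans x≈y (sym (index↦ y)))))
    (index x Fin.≟ index y)
    where
    open Bijection card using (to; injective; strictlySurjective)
    index : Carrier → Fin N
    index z = proj₁ (strictlySurjective z)
    index↦ : ∀ z → to (index z) ≈ z
    index↦ z = proj₂ (strictlySurjective z)

  inClosedNbhd⇒comparable : ∀ {x z a k} → HasOrder G x a → InClosedNbhd G x z → HasOrder G z k → Comparable a k
  inClosedNbhd⇒comparable oˣ (inj₁ z≈x)       oᶻ = inj₁ (∣-reflexive (order-unique oˣ (hasOrder-cong z≈x oᶻ)))
  inClosedNbhd⇒comparable oˣ (inj₂ (_ , adj)) oᶻ = adj _ _ oˣ oᶻ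

  module _ (_≈?_ : Decidable _≈_) where

    comparable⇒inClosedNbhd : ∀ {x z a} → HasOrder G x a → (∀ {k} → HasOrder G z k → Comparable a k) →
      InClosedNbhd G x z
    comparable⇒inClosedNbhd {x} {z} oˣ comparable with z ≈? x
    ... | yes z≈x = inj₁ z≈x
    ... | no z≉x  = inj₂ ((λ x≈z → z≉x (sym x≈z)) ,
                          λ a k oˣ′ oᶻ → ≡.subst (λ a → Comparable a k) (order-unique oˣ oˣ′) (comparable oᶻ))

    module _ {x y a b} (oˣ : HasOrder G x a) (oʸ : HasOrder G y b) where

      nbhd-⊆⇒comparable-⊆ : (∀ z → InClosedNbhd G x z → InClosedNbhd G y z) →
        ∀ {k} → InSpectrum G k → Comparable a k → Comparable b k
      nbhd-⊆⇒comparable-⊆ N[x]⊆N[y] (z , oᶻ) a≍k = inClosedNbhd⇒comparable oʸ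
        (N[x]⊆N[y] z (comparable⇒inClosedNbhd oˣ λ oᶻ′ → ≡.subst (Comparable a) (order-unique oᶻ oᶻ′) a≍k)) oᶻ

      comparable-⊆⇒nbhd-⊆ : (∀ {k} → InSpectrum G k → Comparable a k → Comparable b k) →
        ∀ z → InClosedNbhd G x z → InClosedNbhd G y z
      comparable-⊆⇒nbhd-⊆ comparable z z∈N[x] =
        comparable⇒inClosedNbhd oʸ λ oᶻ → comparable (z , oᶻ) (inClosedNbhd⇒comparable oˣ z∈N[x] oᶻ)

    sameClosedNbhd⇔sameComparabilities : ∀ {x y a b} → HasOrder G x a → HasOrder G y b →
      SameClosedNbhd G x y ⇔ SameComparabilities (InSpectrum G) a b
    sameClosedNbhd⇔sameComparabilities {x} {y} {a} {b} oˣ oʸ = mk⇔ forward backward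
      where
      forward : SameClosedNbhd G x y → SameComparabilities (InSpectrum G) a b
      forward same Sk = mk⇔ (nbhd-⊆⇒comparable-⊆ oˣ oʸ (λ z → Equivalence.to (same z)) Sk)
                            (nbhd-⊆⇒comparable-⊆ oʸ oˣ (λ z → Equivalence.from (same z)) Sk)
      backward : SameComparabilities (InSpectrum G) a b → SameClosedNbhd G x y
      backward same z = mk⇔ (comparable-⊆⇒nbhd-⊆ oˣ oʸ (λ Sk → Equivalence.to (same Sk)) z)
                            (comparable-⊆⇒nbhd-⊆ oʸ oˣ (λ Sk → Equivalence.from (same Sk)) z)

module Cauchy {c ℓ : Level} (G : Group c ℓ) {N : ℕ} (card : HasCardinality G N) where
  open Arithmetic
  open Counting
  open import Data.Nat
  open import Data.Nat.Properties
  open import Data.Nat.Divisibility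
  open import Data.Fin using (Fin)
  open import Data.List using (List; []; _∷_; _∷ʳ_; length; replicate)
  open import Data.List.Properties using (length-replicate)
  open import Data.Product
  open import Function.Base using (_∘_)
  open import Function.Bundles using (Bijection)
  open import Relation.Nullary
  open import Relation.Binary.Definitions using (Decidable)
  open import Relation.Binary.PropositionalEquality as ≡ using (_≡_; _≢_)
  open import Algebra.Properties.CommutativeMonoid.Sum +-0-commutativeMonoid using (sum-syntax)
  open Group G
  open Bijection card using (to; injective; strictlySurjective)
  open import Algebra.Properties.Group G using (inverseʳ-unique)
  open GroupOrders G
  open Tuples N
  open Rotation {A = Fin N}

  product : List (Fin N) → Carrier
  product []      = ε
  product (i ∷ l) = to i ∙ product l

  product-∷ʳ : ∀ l i → product (l ∷ʳ i) ≈ product l ∙ to i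
  product-∷ʳ []      i = trans (identityʳ _) (sym (identityˡ _))
  product-∷ʳ (j ∷ l) i = trans (∙-congˡ (product-∷ʳ l i)) (sym (assoc _ _ _))

  product-replicate : ∀ n i → product (replicate n i) ≈ pow G (to i) n
  product-replicate zero    i = refl
  product-replicate (suc n) i = ∙-congˡ (product-replicate n i)

  ∙≈ε-swap : ∀ {x y} → x ∙ y ≈ ε → y ∙ x ≈ ε
  ∙≈ε-swap {x} {y} xy≈ε = trans (∙-congʳ (inverseʳ-unique x y xy≈ε)) (inverseˡ x)

  _≈?_ : Decidable _≈_
  _≈?_ = ≈-decidable card

  IdentityProduct? : ∀ l → Dec (product l ≈ ε)
  IdentityProduct? l = product l ≈? ε

  count-identityProducts : ∀ k → count (suc k) IdentityProduct? ≡ N ^ k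
  count-identityProducts k = begin
    count (suc k) IdentityProduct?                                       ≡⟨ sumTuples-suc-last k (indicator ∘ IdentityProduct?) ⟩
    sumTuples k (λ l → ∑[ i < N ] indicator (IdentityProduct? (l ∷ʳ i))) ≡⟨ sumTuples-cong k (λ l _ → unique-last l) ⟩
    sumTuples k (λ _ → 1)                                                ≡⟨ sumTuples-const k 1 ⟩
    N ^ k * 1                                                            ≡⟨ *-identityʳ (N ^ k) ⟩
    N ^ k                                                                ∎
    where
    open ≡.≡-Reasoning
    unique-last : ∀ l → ∑[ i < N ] indicator (IdentityProduct? (l ∷ʳ i)) ≡ 1
    unique-last l = let (i₀ , i₀↦) = strictlySurjective (product l ⁻¹) in
      ∑-indicator-unique (IdentityProduct? ∘ (l ∷ʳ_)) {i₀}
        (trans (product-∷ʳ l i₀) (trans (∙-congˡ i₀↦) (inverseʳ _)))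
        λ i l∷ʳi≈ε → injective (trans (inverseʳ-unique _ _ (trans (sym (product-∷ʳ l i)) l∷ʳi≈ε)) (sym i₀↦))

  module _ {k} (pp : Prime (2 + k)) (p∣N : 2 + k ∣ N) where
    open Necklaces {N} pp

    identityProducts : RotationClosed ℓ
    identityProducts = record
      { Q             = λ l → product l ≈ ε
      ; Q?            = IdentityProduct?
      ; rotate-closed = λ {l} → rotate-closed l
      }
      where
      rotate-closed : ∀ l → product l ≈ ε → product (rotate l) ≈ ε
      rotate-closed []      ≈ε = ≈ε
      rotate-closed (i ∷ l) ≈ε = trans (product-∷ʳ l i) (∙≈ε-swap ≈ε)

    open RotationClosed identityProducts using (NonFixed?; countNonFixed)

    i₀ : Fin N
    i₀ = proj₁ (strictlySurjective ε)

    constant-ε : List (Fin N)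
    constant-ε = replicate (2 + k) i₀

    Fixed? : ∀ l → Dec (product l ≈ ε × rotate l ≡ l)
    Fixed? l = IdentityProduct? l ×-dec (rotate l ≟ᵗ l)

    OtherFixed? : ∀ l → Dec ((product l ≈ ε × rotate l ≡ l) × l ≢ constant-ε)
    OtherFixed? l = Fixed? l ×-dec ¬? (l ≟ᵗ constant-ε)

    constant-ε-fixed : product constant-ε ≈ ε × rotate constant-ε ≡ constant-ε
    constant-ε-fixed =
      trans (product-replicate (2 + k) i₀) (trans (pow-congˡ (2 + k) (proj₂ (strictlySurjective ε))) (ε-pow (2 + k))) ,
      rotate-replicate (2 + k) i₀

    countOtherFixed : ℕ
    countOtherFixed = count (2 + k) OtherFixed?

    identityProducts-split : N ^ suc k ≡ (1 + countOtherFixed) + countNonFixed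
    identityProducts-split = begin
      N ^ suc k                                      ≡⟨ count-identityProducts (suc k) ⟨
      count (2 + k) IdentityProduct?                 ≡⟨ count-split (2 + k) IdentityProduct? (λ l → rotate l ≟ᵗ l) ⟩
      count (2 + k) Fixed? + countNonFixed           ≡⟨ ≡.cong (_+ countNonFixed) count-Fixed ⟩
      (1 + countOtherFixed) + countNonFixed          ∎
      where
      open ≡.≡-Reasoning
      at-constant-ε : ∀ l → indicator (Fixed? l ×-dec (l ≟ᵗ constant-ε)) ≡ indicator (l ≟ᵗ constant-ε)
      at-constant-ε l = indicator-⇔ (Fixed? l ×-dec (l ≟ᵗ constant-ε)) (l ≟ᵗ constant-ε) proj₂
        λ l≡c → ≡.subst (λ m → product m ≈ ε × rotate m ≡ m) (≡.sym l≡c) constant-ε-fixed , l≡c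
      count-Fixed : count (2 + k) Fixed? ≡ 1 + countOtherFixed
      count-Fixed = begin
        count (2 + k) Fixed?
          ≡⟨ count-split (2 + k) Fixed? (_≟ᵗ constant-ε) ⟩
        count (2 + k) (λ l → Fixed? l ×-dec (l ≟ᵗ constant-ε)) + countOtherFixed
          ≡⟨ ≡.cong (_+ countOtherFixed) (sumTuples-cong (2 + k) λ l _ → at-constant-ε l) ⟩
        count (2 + k) (_≟ᵗ constant-ε) + countOtherFixed
          ≡⟨ ≡.cong (_+ countOtherFixed) (sumTuples-indicator-≡ (2 + k) constant-ε (length-replicate (2 + k))) ⟩
        1 + countOtherFixed ∎

    countOtherFixed≢0 : countOtherFixed ≢ 0
    countOtherFixed≢0 count≡0 = prime≢1 pp (∣1⇒≡1 (≡.subst (λ c → 2 + k ∣ 1 + c) count≡0 p∣1+count))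
      where
      p∣1+count : 2 + k ∣ 1 + countOtherFixed
      p∣1+count = ∣m+n∣m⇒∣n
        (≡.subst (2 + k ∣_) (≡.trans identityProducts-split (+-comm (1 + countOtherFixed) countNonFixed))
                 (∣m⇒∣m*n (N ^ k) p∣N))
        (p∣countNonFixed identityProducts)

    fixed-tuple⇒order-p : ∀ {l} → length l ≡ 2 + k → (product l ≈ ε × rotate l ≡ l) × l ≢ constant-ε →
      InSpectrum G (2 + k)
    fixed-tuple⇒order-p {a ∷ t} ∣a∷t∣≡p ((a∷t≈ε , fixed) , ≢constant-ε) =
      to a , s≤s z≤n , aᵖ≈ε , no-smaller-power
      where
      a∷t≡ : a ∷ t ≡ replicate (2 + k) a
      a∷t≡ = ≡.cong (a ∷_) (≡.trans (rotate-fixed⇒replicate a t fixed)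
                                    (≡.cong (λ n → replicate n a) (suc-injective ∣a∷t∣≡p)))
      aᵖ≈ε : pow G (to a) (2 + k) ≈ ε
      aᵖ≈ε = trans (sym (product-replicate (2 + k) a)) (≡.subst (λ m → product m ≈ ε) a∷t≡ a∷t≈ε)
      a≉ε : ¬ to a ≈ ε
      a≉ε a≈ε = ≢constant-ε (≡.trans a∷t≡ (≡.cong (replicate (2 + k))
                  (injective (trans a≈ε (sym (proj₂ (strictlySurjective ε)))))))
      open DifferenceClosed (annihilators (to a))
      no-smaller-power : ∀ j → 1 ≤ j → j < 2 + k → ¬ pow G (to a) j ≈ ε
      no-smaller-power j j≥1 j<p aʲ≈ε = a≉ε (trans (sym (identityʳ (to a))) (prime⇒1∈ pp j≥1 j<p aʲ≈ε aᵖ≈ε))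

    element-of-prime-order : InSpectrum G (2 + k)
    element-of-prime-order = from-witness (sumTuples≢0⇒∃≢0 (2 + k) (indicator ∘ OtherFixed?) countOtherFixed≢0)
      where
      from-witness : (∃[ l ] length l ≡ 2 + k × indicator (OtherFixed? l) ≢ 0) → InSpectrum G (2 + k)
      from-witness (l , ∣l∣≡p , indicator≢0) =
        fixed-tuple⇒order-p ∣l∣≡p (indicator≢0⇒ (OtherFixed? l) indicator≢0)

  cauchy : ∀ {p} → Prime p → p ∣ N → InSpectrum G p
  cauchy {0}           pp = contradiction (prime>1 pp) λ ()
  cauchy {1}           pp = contradiction (prime>1 pp) λ { (s≤s ()) }
  cauchy {suc (suc k)} pp = element-of-prime-order pp

lemma3p4 : {c ℓ : Level} (G : Group c ℓ) (N : ℕ) → HasCardinality G N →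
    (∃ λ p → ∃ λ q → Prime p × Prime q × p ≢ q × p ∣ N × q ∣ N) →
    (x y : Group.Carrier G) → ¬ (Group._≈_ G x y) →
    (ox oy e : ℕ) → HasOrder G x ox → HasOrder G y oy → IsExponent G e →
    SameClosedNbhd G x y ⇔
      ((ox ≡ oy)
       ⊎ (((ox ≡ 1) × (oy ≡ e)) ⊎ ((ox ≡ e) × (oy ≡ 1)))
       ⊎ (∃ λ p → ∃ λ m → ∃ λ n → Prime p × 1 ≤ n × n < m
           × (((ox ≡ p ^ m) × (oy ≡ p ^ n)) ⊎ ((ox ≡ p ^ n) × (oy ≡ p ^ m)))
           × (∀ q → Prime q → q ≢ p → ¬ InSpectrum G (p ^ n * q))))
lemma3p4 G N card (p , q , pp , pq , p≢q , p∣N , q∣N) x y _ ox oy e oˣ oʸ exponent =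
  sameComparabilities⇔condition pp pq p≢q (cauchy pp p∣N) (cauchy pq q∣N) lcm (x , oˣ) (y , oʸ)
  ⇔-∘ sameClosedNbhd⇔sameComparabilities (≈-decidable card) oˣ oʸ
  where
  open OrderSpectra using (IsLcm; module DivisorClosed)
  open GroupOrders G
  open Cauchy G card using (cauchy)
  open DivisorClosed (InSpectrum G) inSpectrum⇒>0 inSpectrum-∣-closed
  lcm : IsLcm (InSpectrum G) e
  lcm = (λ (z , oᶻ) → proj₁ exponent z _ oᶻ) , λ bound → proj₂ exponent _ λ z k oᶻ → bound (z , oᶻ)
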